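{- For every integer $n\geq 2$, $$a_n(4312,4321;213)=a_n(3421,4321;312)=2^{n-2}.$$
   Context: A permutation $\pi$ of $[n]=\{1,\dots,n\}$ is cyclic if it consists of a single $n$-cycle. Its one-line notation is $\pi_1\pi_2\cdots\pi_n$ with $\pi_i=\pi(i)$. Its standard cycle form is $(c_1,c_2,\dots,c_n)$ with $c_1=1$ and $c_{i+1}=\pi(c_i)$ for $1\le i<n$. A sequence $w_1\cdots w_n$ of distinct integers contains a pattern $\sigma=\sigma_1\cdots\sigma_k\in S_k$ if there are indices $i_1<\dots<i_k$ with $w_{i_s}>w_{i_t}$ iff $\sigma_s>\sigma_t$ for all $s<t$; otherwise it avoids $\sigma$. $\mathcal{A}_n(\sigma_1,\dots,\sigma_l;\rho)$ is the set of cyclic permutations of $[n]$ whose one-line notation avoids each $\sigma_i$ and whose standard cycle form $c_1\cdots c_n$, read as a sequence, avoids $\rho$; $a_n(\sigma_1,\dots,\sigma_l;\rho)$ is its cardinality. -}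

module Defs where

open import Data.Nat using (ℕ; zero; suc; _<_; _>_)
open import Data.Fin as F using (Fin; toℕ; cast)
open import Data.List using (List; []; _∷_; length; map; upTo; lookup)
open import Data.List.Relation.Binary.Sublist.Propositional using (_⊆_)
open import Data.List.Relation.Unary.All using (All)
open import Data.List.Relation.Unary.Unique.Propositional using (Unique)
open import Data.List.Membership.Propositional using (_∈_)
open import Data.Vec as V using (Vec)
open import Data.Product using (Σ; ∃; _×_)
open import Function.Bundles using (_⇔_)
open import Relation.Nullary using (¬_)
open import Relation.Binary.PropositionalEquality using (_≡_)

iter : {A : Set} → (A → A) → ℕ → A → A
iter f zero    x = x
iter f (suc k) x = f (iter f k x)

-- Permutations of [n] in one-line notation: the entry at position i
-- (0-based Fin index i, standing for i+1) is π(i+1) - 1.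
Perm : ℕ → Set
Perm n = Vec (Fin n) n

app : {n : ℕ} → Perm n → Fin n → Fin n
app π i = V.lookup π i

-- π is a bijection of [n] (injective self-map of a finite set)
IsPerm : {n : ℕ} → Perm n → Set
IsPerm {n} π = ∀ (i j : Fin n) → app π i ≡ app π j → i ≡ j

IsCyclic : {n : ℕ} → Perm n → Set
IsCyclic {n} π = IsPerm π × (∀ (i j : Fin n) → ∃ λ k → iter (app π) k i ≡ j)

oneLine : {n : ℕ} → Perm n → List ℕ
oneLine π = map (λ i → suc (toℕ i)) (V.toList π)

-- standard cycle form (c_1, ..., c_n), c_1 = 1, c_{i+1} = π(c_i)
cycleForm : {n : ℕ} → Perm n → List ℕ
cycleForm {zero}  π = []
cycleForm {suc m} π = map (λ k → suc (toℕ (iter (app π) k F.zero))) (upTo (suc m))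

OrderIso : List ℕ → List ℕ → Set
OrderIso u σ = Σ (length u ≡ length σ) λ eq →
  ∀ (s t : Fin (length u)) → s F.< t →
    (lookup u s > lookup u t) ⇔ (lookup σ (cast eq s) > lookup σ (cast eq t))

Contains : List ℕ → List ℕ → Set
Contains w σ = ∃ λ u → (u ⊆ w) × OrderIso u σ

Avoids : List ℕ → List ℕ → Set
Avoids w σ = ¬ Contains w σ

InA : (n : ℕ) → List (List ℕ) → List ℕ → Perm n → Set
InA n σs ρ π = IsCyclic π × All (Avoids (oneLine π)) σs × Avoids (cycleForm π) ρ

HasCard : {A : Set} → (A → Set) → ℕ → Set
HasCard {A} P k = ∃ λ (L : List A) → Unique L × (∀ x → (x ∈ L) ⇔ P x) × length L ≡ k

aCount : (n : ℕ) → List (List ℕ) → List ℕ → ℕ → Set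
aCount n σs ρ k = HasCard (InA n σs ρ) k

{-# OPTIONS --safe #-}
-- Let π be cyclic on [n], n ≥ 3, with cycle form (1, c₂, …, cₙ), and look at where 2 sits.
-- If 2 comes right after 1 (π(1) = 2) or right before it (π(2) = 1), then π arises from a unique
-- cyclic permutation of [n-1] by raising the values 2, …, n-1 and inserting 2 at that place. Both
-- insertions preserve and reflect membership in either class: in one-line notation they add a
-- leading 2, resp. a 1 in second place, which no occurrence of 4312, 4321 or 3421 can use, and in
-- the cycle form they add a leading 1, resp. a trailing 2 below every entry but the first, which no
-- occurrence of 213 or 312 can use.
-- Otherwise the cycle reads (1, a, …, μ, 2, b, …, ℓ) with a = π(1), b = π(2), π(μ) = 2, π(ℓ) = 1.
-- If a < b then (a, 2, b) is a 213 in the cycle form, if μ < ℓ then so is (μ, 2, ℓ), and if b < a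
-- and ℓ < μ then the one-line entries a, b, 1, 2 at positions 1, 2, ℓ, μ form a 4312. Symmetrically
-- one finds a 312 in the cycle form or a 3421 in one-line notation. So each class consists of the
-- 2ⁿ⁻² distinct permutations obtained from 21 by n - 2 insertions.
module Submission where

open import Defs
open import Data.Empty using (⊥; ⊥-elim)
open import Data.Fin as F using (Fin; toℕ; punchIn)
open import Data.Fin.Patterns using (0F; 1F)
import Data.Fin.Properties as FP
open import Data.List as L using (List; []; _∷_; _++_; map; length; upTo; applyUpTo)
open import Data.List.Membership.Propositional using (_∈_)
open import Data.List.Membership.Propositional.Properties using (∈-map⁺; ∈-map⁻; ∈-++⁺ˡ; ∈-++⁺ʳ; ∈-++⁻)
import Data.List.Properties as LP
open import Data.List.Relation.Binary.Pointwise as Pw using (Pointwise; []; _∷_)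
import Data.List.Relation.Binary.Pointwise.Properties as PwP
open import Data.List.Relation.Binary.Sublist.Propositional using (_⊆_; []; _∷_; _∷ʳ_; ⊆-refl; ⊆-trans; minimum)
import Data.List.Relation.Binary.Sublist.Propositional.Properties as SubP
open import Data.List.Relation.Unary.All as All using (All; []; _∷_)
import Data.List.Relation.Unary.All.Properties as AllP
import Data.List.Relation.Unary.AllPairs as AllPairs
open import Data.List.Relation.Unary.Any using (Any; here; there)
open import Data.List.Relation.Unary.Unique.Propositional using (Unique)
import Data.List.Relation.Unary.Unique.Propositional.Properties as UniqueP
open import Data.Nat using (ℕ; zero; suc; _+_; _*_; _∸_; _^_; _≤_; _<_; _>_; z≤n; s≤s; z<s; s<s; s≤s⁻¹; _≤?_)
open import Data.Nat.Properties
open import Data.Product using (∃; ∃₂; _×_; _,_; proj₁; proj₂)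
open import Data.Sum using (_⊎_; inj₁; inj₂; [_,_]′)
open import Data.Vec as V using (Vec; _∷_; [])
import Data.Vec.Properties as VP
open import Function.Base using (_∘_; id)
open import Function.Bundles using (_⇔_; mk⇔; Equivalence)
open import Function.Construct.Composition using (_⇔-∘_)
open import Function.Construct.Symmetry using (⇔-sym)
open import Relation.Binary.Definitions using (tri<; tri≈; tri>)
open import Relation.Binary.PropositionalEquality
  using (_≡_; _≢_; refl; sym; trans; cong; cong₂; subst; subst₂; module ≡-Reasoning)
open import Relation.Nullary using (¬_; yes; no)
open import Relation.Nullary.Decidable using (True; toWitness)

open Equivalence using (to; from)

private
  variable
    A B : Set
    n i j k x y z p q r : ℕ
    u w σ τ : List ℕ

  auto : ∀ {m n} {_ : True (m ≤? n)} → m ≤ n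
  auto {_} {_} {m≤n} = toWitness m≤n

SameOrder : ℕ → ℕ → ℕ → ℕ → Set
SameOrder x y p q = (x > y) ⇔ (p > q)

sameOrder-> : y < x → q < p → SameOrder x y p q
sameOrder-> y<x q<p = mk⇔ (λ _ → q<p) (λ _ → y<x)

sameOrder-≤ : x ≤ y → p ≤ q → SameOrder x y p q
sameOrder-≤ x≤y p≤q = mk⇔ (⊥-elim ∘ ≤⇒≯ x≤y) (⊥-elim ∘ ≤⇒≯ p≤q)

orderIso-[] : OrderIso [] []
orderIso-[] = refl , λ ()

orderIso-∷ : OrderIso (x ∷ u) (p ∷ τ) ⇔ (Pointwise (λ y q → SameOrder x y p q) u τ × OrderIso u τ)
orderIso-∷ {x} {u} {p} {τ} = mk⇔ split join
  where
  split : OrderIso (x ∷ u) (p ∷ τ) → Pointwise (λ y q → SameOrder x y p q) u τ × OrderIso u τ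
  split (eq , cmp) = Pw.lookup⁻ (suc-injective eq) with-head ,
                     (suc-injective eq , λ s t s<t → cmp (F.suc s) (F.suc t) (s<s s<t))
    where
    with-head : ∀ {i j} → toℕ i ≡ toℕ j → SameOrder x (L.lookup u i) p (L.lookup τ j)
    with-head {i} i≡j = subst (λ k → SameOrder x (L.lookup u i) p (L.lookup τ k))
      (FP.toℕ-injective (trans (FP.toℕ-cast _ i) i≡j)) (cmp F.zero (F.suc i) z<s)
  join : Pointwise (λ y q → SameOrder x y p q) u τ × OrderIso u τ → OrderIso (x ∷ u) (p ∷ τ)
  join (pw , eq , cmp) = cong suc eq , λ
    { F.zero    (F.suc t) _         → PwP.lookup-cast pw _ t
    ; (F.suc s) (F.suc t) (s<s s<t) → cmp s t s<t
    }

orderIso-tail : OrderIso (x ∷ u) (p ∷ τ) → OrderIso u τ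
orderIso-tail = proj₂ ∘ to orderIso-∷

orderIso₃ : SameOrder x y p q → SameOrder x z p r → SameOrder y z q r →
            OrderIso (x ∷ y ∷ z ∷ []) (p ∷ q ∷ r ∷ [])
orderIso₃ xy xz yz =
  from orderIso-∷ (xy ∷ xz ∷ [] , from orderIso-∷ (yz ∷ [] , from orderIso-∷ ([] , orderIso-[])))

orderIso₄ : ∀ {x₁ x₂ x₃ x₄ p₁ p₂ p₃ p₄} →
            SameOrder x₁ x₂ p₁ p₂ → SameOrder x₁ x₃ p₁ p₃ → SameOrder x₁ x₄ p₁ p₄ →
            SameOrder x₂ x₃ p₂ p₃ → SameOrder x₂ x₄ p₂ p₄ → SameOrder x₃ x₄ p₃ p₄ →
            OrderIso (x₁ ∷ x₂ ∷ x₃ ∷ x₄ ∷ []) (p₁ ∷ p₂ ∷ p₃ ∷ p₄ ∷ [])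
orderIso₄ e₁₂ e₁₃ e₁₄ e₂₃ e₂₄ e₃₄ = from orderIso-∷ (e₁₂ ∷ e₁₃ ∷ e₁₄ ∷ [] , orderIso₃ e₂₃ e₂₄ e₃₄)

OrderEquivalent : (A → ℕ) → (A → ℕ) → Set
OrderEquivalent f g = ∀ a b → (f a < f b) ⇔ (g a < g b)

orderEquivalent-sym : {f g : A → ℕ} → OrderEquivalent f g → OrderEquivalent g f
orderEquivalent-sym f≈g a b = ⇔-sym (f≈g a b)

suc-orderEquivalent : (f : A → ℕ) → OrderEquivalent (suc ∘ f) f
suc-orderEquivalent f a b = mk⇔ s≤s⁻¹ s≤s

orderIso-map : {f g : A → ℕ} → OrderEquivalent f g → ∀ xs {σ} → OrderIso (map f xs) σ → OrderIso (map g xs) σ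
orderIso-map f≈g []       {[]}    _     = orderIso-[]
orderIso-map {f = f} {g} f≈g (a ∷ as) {p ∷ τ} f-iso with to orderIso-∷ f-iso
... | pairs , tail-iso = from orderIso-∷ (transport pairs , orderIso-map f≈g as {τ} tail-iso)
  where
  transport : ∀ {bs ρ} → Pointwise (λ y q → SameOrder (f a) y p q) (map f bs) ρ →
              Pointwise (λ y q → SameOrder (g a) y p q) (map g bs) ρ
  transport {[]}     []       = []
  transport {b ∷ bs} (e ∷ es) = (e ⇔-∘ ⇔-sym (f≈g b a)) ∷ transport es

¬orderIso-least-head : Any (_< p) τ → All (x ≤_) u → ¬ OrderIso (x ∷ u) (p ∷ τ)
¬orderIso-least-head {p} {x = x} below x≤u iso = go below x≤u (proj₁ (to orderIso-∷ iso))
  where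
  go : ∀ {u τ} → Any (_< p) τ → All (x ≤_) u → ¬ Pointwise (λ y q → SameOrder x y p q) u τ
  go (here q<p) (x≤y ∷ _)   (e ∷ _)  = ≤⇒≯ x≤y (from e q<p)
  go (there b)  (_   ∷ x≤u) (_ ∷ es) = go b x≤u es

data DescentBelow (p : ℕ) : List ℕ → Set where
  here  : q < p → Any (_< q) τ → DescentBelow p (q ∷ τ)
  there : DescentBelow p τ → DescentBelow p (q ∷ τ)

-- The entry matched with q is below 2, hence a least entry, so the head lemma applies to it.
¬orderIso-2-head : DescentBelow p τ → All (1 ≤_) u → ¬ OrderIso (2 ∷ u) (p ∷ τ)
¬orderIso-2-head {p} descent positive iso = go descent positive (to orderIso-∷ iso)
  where
  go : ∀ {u τ} → DescentBelow p τ → All (1 ≤_) u →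
       ¬ (Pointwise (λ y q → SameOrder 2 y p q) u τ × OrderIso u τ)
  go (here q<p below) (_ ∷ pos) (e ∷ _ , iso)  =
    ¬orderIso-least-head below (All.map (≤-trans (s≤s⁻¹ (from e q<p))) pos) iso
  go (there d)        (_ ∷ pos) (_ ∷ es , iso) = go d pos (es , orderIso-tail iso)

pointwise-last : ∀ {R : ℕ → ℕ → Set} u τ → Pointwise R (u ++ z ∷ []) (τ ++ r ∷ []) → R z r
pointwise-last []          []          (e ∷ []) = e
pointwise-last (_ ∷ u)     (_ ∷ τ)     (_ ∷ es) = pointwise-last u τ es
pointwise-last []          (_ ∷ [])    (_ ∷ ())
pointwise-last []          (_ ∷ _ ∷ _) (_ ∷ ())
pointwise-last (_ ∷ [])    []          (_ ∷ ())
pointwise-last (_ ∷ _ ∷ _) []          (_ ∷ ())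

¬orderIso-least-last : Any (_< r) τ → All (z <_) u → ¬ OrderIso (u ++ z ∷ []) (τ ++ r ∷ [])
¬orderIso-least-last {τ = q ∷ τ} {u = y ∷ u} below (z<y ∷ z<u) iso with to orderIso-∷ iso | below
... | pairs , _        | here q<r = <-asym q<r (to (pointwise-last u τ pairs) z<y)
... | _     , tail-iso | there b  = ¬orderIso-least-last b z<u tail-iso
¬orderIso-least-last {τ = _ ∷ []}    {u = []} _ _ (() , _)
¬orderIso-least-last {τ = _ ∷ _ ∷ _} {u = []} _ _ (() , _)

contains-⊆ : w ⊆ u → Contains w σ → Contains u σ
contains-⊆ w⊆u (v , v⊆w , iso) = v , ⊆-trans v⊆w w⊆u , iso

avoids-shorter : length w < length σ → Avoids w σ
avoids-shorter w<σ (v , v⊆w , eq , _) = <⇒≱ w<σ (subst (_≤ _) eq (SubP.length-mono-≤ v⊆w))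

avoids-cong : Contains w σ ⇔ Contains u σ → Avoids w σ ⇔ Avoids u σ
avoids-cong w⇔u = mk⇔ (λ avoid → avoid ∘ from w⇔u) (λ avoid → avoid ∘ to w⇔u)

all-avoids : {P : List ℕ → Set} {σs : List (List ℕ)} → All P σs →
             (∀ {σ} → P σ → Contains w σ ⇔ Contains u σ) → All (Avoids w) σs ⇔ All (Avoids u) σs
all-avoids ps w⇔u = mk⇔
  (λ avoid → All.zipWith (λ {σ} (p , a) → to (avoids-cong {σ = σ} (w⇔u p)) a) (ps , avoid))
  (λ avoid → All.zipWith (λ {σ} (p , a) → from (avoids-cong {σ = σ} (w⇔u p)) a) (ps , avoid))

⊆-map⁻ : (f : A → ℕ) (xs : List A) → u ⊆ map f xs → ∃ λ ys → ys ⊆ xs × u ≡ map f ys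
⊆-map⁻ f []       []          = [] , [] , refl
⊆-map⁻ f (x ∷ xs) (_ ∷ʳ u⊆)   with ⊆-map⁻ f xs u⊆
... | ys , ys⊆xs , refl = ys , x ∷ʳ ys⊆xs , refl
⊆-map⁻ f (x ∷ xs) (refl ∷ u⊆) with ⊆-map⁻ f xs u⊆
... | ys , ys⊆xs , refl = x ∷ ys , refl ∷ ys⊆xs , refl

contains-map : {f g : A → ℕ} → OrderEquivalent f g → ∀ xs → Contains (map f xs) σ → Contains (map g xs) σ
contains-map {σ = σ} {f = f} {g} f≈g xs (u , u⊆ , iso) with ⊆-map⁻ f xs u⊆
... | ys , ys⊆xs , refl = map g ys , SubP.map⁺ g ys⊆xs , orderIso-map f≈g ys {σ} iso

contains-map-suc : Contains (map suc w) σ ⇔ Contains w σ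
contains-map-suc {w} {σ} = mk⇔
  (subst (λ v → Contains v σ) (LP.map-id w) ∘ contains-map {σ = σ} (suc-orderEquivalent id) w)
  (contains-map {σ = σ} (orderEquivalent-sym (suc-orderEquivalent id)) w
    ∘ subst (λ v → Contains v σ) (sym (LP.map-id w)))

contains-∷⁻ : {P : ℕ → Set} → (∀ {u} → All P u → ¬ OrderIso (x ∷ u) σ) →
              All P w → Contains (x ∷ w) σ → Contains w σ
contains-∷⁻ _        _  (u , _ ∷ʳ u⊆w   , iso) = u , u⊆w , iso
contains-∷⁻ not-at-x Pw (_ , refl ∷ u⊆w , iso) = ⊥-elim (not-at-x (SubP.All-resp-⊆ u⊆w Pw) iso)

contains-∷∷⁻ : {P : ℕ → Set} → (∀ {u} → All P u → ¬ OrderIso (y ∷ u) σ) →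
               (∀ {u} → All P u → ¬ OrderIso (x ∷ y ∷ u) σ) →
               All P w → Contains (x ∷ y ∷ w) σ → Contains (x ∷ w) σ
contains-∷∷⁻ _ _ _  (u , _ ∷ʳ (_ ∷ʳ u⊆w)   , iso) = u , _ ∷ʳ u⊆w , iso
contains-∷∷⁻ _ _ _  (u , refl ∷ (_ ∷ʳ u⊆w) , iso) = u , refl ∷ u⊆w , iso
contains-∷∷⁻ not-at-y _ Pw (_ , _ ∷ʳ (refl ∷ u⊆w) , iso) =
  ⊥-elim (not-at-y (SubP.All-resp-⊆ u⊆w Pw) iso)
contains-∷∷⁻ _ not-at-xy Pw (_ , refl ∷ (refl ∷ u⊆w) , iso) =
  ⊥-elim (not-at-xy (SubP.All-resp-⊆ u⊆w Pw) iso)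

⊆-∷ʳ⁻ : {v : List A} (w : List A) {a : A} → v ⊆ w ++ a ∷ [] →
        v ⊆ w ⊎ ∃ λ v′ → v′ ⊆ w × v ≡ v′ ++ a ∷ []
⊆-∷ʳ⁻ []      (_ ∷ʳ [])   = inj₁ []
⊆-∷ʳ⁻ []      (refl ∷ []) = inj₂ ([] , [] , refl)
⊆-∷ʳ⁻ (b ∷ w) (_ ∷ʳ v⊆)   with ⊆-∷ʳ⁻ w v⊆
... | inj₁ v⊆w              = inj₁ (b ∷ʳ v⊆w)
... | inj₂ (v′ , v′⊆w , eq) = inj₂ (v′ , b ∷ʳ v′⊆w , eq)
⊆-∷ʳ⁻ (b ∷ w) (refl ∷ v⊆) with ⊆-∷ʳ⁻ w v⊆
... | inj₁ v⊆w              = inj₁ (refl ∷ v⊆w)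
... | inj₂ (v′ , v′⊆w , eq) = inj₂ (b ∷ v′ , refl ∷ v′⊆w , cong (b ∷_) eq)

contains-∷ʳ⁻ : {P : ℕ → Set} → (∀ {u} → All P u → ¬ OrderIso (u ++ z ∷ []) σ) →
               All P w → Contains (w ++ z ∷ []) σ → Contains w σ
contains-∷ʳ⁻ {w = w} not-at-z Pw (u , u⊆ , iso) with ⊆-∷ʳ⁻ w u⊆
... | inj₁ u⊆w              = u , u⊆w , iso
... | inj₂ (v , v⊆w , refl) = ⊥-elim (not-at-z (SubP.All-resp-⊆ v⊆w Pw) iso)

σ4312 σ4321 σ3421 σ213 σ312 : List ℕ
σ4312 = 4 ∷ 3 ∷ 1 ∷ 2 ∷ []
σ4321 = 4 ∷ 3 ∷ 2 ∷ 1 ∷ []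
σ3421 = 3 ∷ 4 ∷ 2 ∷ 1 ∷ []
σ213  = 2 ∷ 1 ∷ 3 ∷ []
σ312  = 3 ∷ 1 ∷ 2 ∷ []

-- Conditions under which avoiding σ (resp. ρ) in one-line notation (resp. the cycle form) is
-- unaffected by the insertions defined below.
record OneLineStable (σ : List ℕ) : Set where
  field
    no-head-2   : ∀ {u} → All (1 ≤_) u → ¬ OrderIso (2 ∷ u) σ
    no-head-1   : ∀ {u} → All (1 ≤_) u → ¬ OrderIso (1 ∷ u) σ
    no-second-1 : ∀ {x u} → All (1 ≤_) u → ¬ OrderIso (x ∷ 1 ∷ u) σ

record CycleStable (ρ : List ℕ) : Set where
  field
    no-head-1 : ∀ {u} → All (1 ≤_) u → ¬ OrderIso (1 ∷ u) ρ
    no-last-2 : ∀ {u} → All (3 ≤_) u → ¬ OrderIso (u ++ 2 ∷ []) ρ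

4312-stable : OneLineStable σ4312
4312-stable = record
  { no-head-2   = ¬orderIso-2-head (here auto (here auto))
  ; no-head-1   = ¬orderIso-least-head (here auto)
  ; no-second-1 = λ pos → ¬orderIso-least-head (here auto) pos ∘ orderIso-tail
  }

4321-stable : OneLineStable σ4321
4321-stable = record
  { no-head-2   = ¬orderIso-2-head (here auto (here auto))
  ; no-head-1   = ¬orderIso-least-head (here auto)
  ; no-second-1 = λ pos → ¬orderIso-least-head (here auto) pos ∘ orderIso-tail
  }

3421-stable : OneLineStable σ3421
3421-stable = record
  { no-head-2   = ¬orderIso-2-head (there (here auto (here auto)))
  ; no-head-1   = ¬orderIso-least-head (there (here auto))
  ; no-second-1 = λ pos → ¬orderIso-least-head (here auto) pos ∘ orderIso-tail
  }

213-stable : CycleStable σ213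
213-stable = record
  { no-head-1 = ¬orderIso-least-head (here auto)
  ; no-last-2 = ¬orderIso-least-last {τ = 2 ∷ 1 ∷ []} (here auto)
  }

312-stable : CycleStable σ312
312-stable = record
  { no-head-1 = ¬orderIso-least-head (here auto)
  ; no-last-2 = ¬orderIso-least-last {τ = 3 ∷ 1 ∷ []} (there (here auto))
  }

213-occurrence : y < x → x ≤ z → OrderIso (x ∷ y ∷ z ∷ []) σ213
213-occurrence y<x x≤z =
  orderIso₃ (sameOrder-> y<x auto) (sameOrder-≤ x≤z auto) (sameOrder-≤ (≤-trans (<⇒≤ y<x) x≤z) auto)

312-occurrence : y ≤ z → z < x → OrderIso (x ∷ y ∷ z ∷ []) σ312
312-occurrence y≤z z<x =
  orderIso₃ (sameOrder-> (≤-<-trans y≤z z<x) auto) (sameOrder-> z<x auto) (sameOrder-≤ y≤z auto)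

4312-occurrence : ∀ {a b c d} → c ≤ d → d < b → b < a → OrderIso (a ∷ b ∷ c ∷ d ∷ []) σ4312
4312-occurrence c≤d d<b b<a = orderIso₄
  (sameOrder-> b<a auto) (sameOrder-> (<-trans (≤-<-trans c≤d d<b) b<a) auto)
  (sameOrder-> (<-trans d<b b<a) auto) (sameOrder-> (≤-<-trans c≤d d<b) auto)
  (sameOrder-> d<b auto) (sameOrder-≤ c≤d auto)

3421-occurrence : ∀ {a b c d} → d < c → c < a → a ≤ b → OrderIso (a ∷ b ∷ c ∷ d ∷ []) σ3421
3421-occurrence d<c c<a a≤b = orderIso₄
  (sameOrder-≤ a≤b auto) (sameOrder-> c<a auto) (sameOrder-> (<-trans d<c c<a) auto)
  (sameOrder-> (<-≤-trans c<a a≤b) auto) (sameOrder-> (<-≤-trans (<-trans d<c c<a) a≤b) auto)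
  (sameOrder-> d<c auto)

iter-+ : ∀ (f : A → A) m k a → iter f (m + k) a ≡ iter f m (iter f k a)
iter-+ f zero    k a = refl
iter-+ f (suc m) k a = cong f (iter-+ f m k a)

iter-injective : {f : A → A} → (∀ a b → f a ≡ f b → a ≡ b) → ∀ k {a b} → iter f k a ≡ iter f k b → a ≡ b
iter-injective inj zero    eq = eq
iter-injective inj (suc k) eq = iter-injective inj k (inj _ _ eq)

iter-fixed : {f : A → A} {a : A} → f a ≡ a → ∀ k → iter f k a ≡ a
iter-fixed         fa≡a zero    = refl
iter-fixed {f = f} fa≡a (suc k) = trans (cong f (iter-fixed fa≡a k)) fa≡a

iter-descends : {f : A → A} {g : B → B} (h : A → B) → (∀ a → h (f a) ≡ h a ⊎ h (f a) ≡ g (h a)) →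
                ∀ k a → ∃ λ k′ → iter g k′ (h a) ≡ h (iter f k a)
iter-descends h step zero    a = 0 , refl
iter-descends {f = f} {g} h step (suc k) a with iter-descends h step k a | step (iter f k a)
... | k′ , eq | inj₁ stays = k′ , trans eq (sym stays)
... | k′ , eq | inj₂ moves = suc k′ , trans (cong g eq) (sym moves)

orbits-descend : {f : A → A} {g : B → B} (h : A → B) (s : B → A) → (∀ b → h (s b) ≡ b) →
                 (∀ a → h (f a) ≡ h a ⊎ h (f a) ≡ g (h a)) →
                 (∀ a a′ → ∃ λ k → iter f k a ≡ a′) → ∀ b b′ → ∃ λ k → iter g k b ≡ b′
orbits-descend {g = g} h s h∘s≗id step connected b b′ with connected (s b) (s b′)
... | k , eq with iter-descends h step k (s b)
...   | k′ , eq′ = k′ , trans (cong (iter g k′) (sym (h∘s≗id b))) (trans eq′ (trans (cong h eq) (h∘s≗id b′)))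

orbit : Perm (suc n) → ℕ → Fin (suc n)
orbit π k = iter (app π) k 0F

module Orbit {n} (π : Perm (suc n)) (inj : IsPerm π) where

  orbit-shift : i ≤ j → orbit π i ≡ orbit π j → orbit π (j ∸ i) ≡ 0F
  orbit-shift {i} {j} i≤j eq = iter-injective inj i (begin
    iter (app π) i (orbit π (j ∸ i)) ≡⟨ sym (iter-+ (app π) i (j ∸ i) 0F) ⟩
    orbit π (i + (j ∸ i))            ≡⟨ cong (orbit π) (m+[n∸m]≡n i≤j) ⟩
    orbit π j                        ≡⟨ sym eq ⟩
    orbit π i                        ∎)
    where open ≡-Reasoning

  orbit-returns : ∃ λ r → 0 < r × r ≤ suc n × orbit π r ≡ 0F
  orbit-returns with FP.pigeonhole (n<1+n (suc n)) (orbit π ∘ toℕ)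
  ... | i , j , i<j , eq = toℕ j ∸ toℕ i , m<n⇒0<n∸m i<j ,
    ≤-trans (m∸n≤m (toℕ j) (toℕ i)) (s≤s⁻¹ (FP.toℕ<n j)) , orbit-shift (<⇒≤ i<j) eq

  orbit-multiple : orbit π r ≡ 0F → ∀ a → orbit π (a * r) ≡ 0F
  orbit-multiple     ret zero    = refl
  orbit-multiple {r} ret (suc a) = trans (iter-+ (app π) r (a * r) 0F)
    (trans (cong (iter (app π) r) (orbit-multiple ret a)) ret)

  -- With return time suc r, another a * r steps lead from orbit π a to orbit π (a * suc r) = 0F.
  cyclic-from-orbit : (∀ y → ∃ λ k → orbit π k ≡ y) → IsCyclic π
  cyclic-from-orbit reach = inj , connect
    where
    connect : ∀ i j → ∃ λ k → iter (app π) k i ≡ j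
    connect i j with reach i | reach j | orbit-returns
    ... | a , refl | b , refl | suc r , _ , _ , ret = b + a * r , (begin
      iter (app π) (b + a * r) (orbit π a) ≡⟨ sym (iter-+ (app π) (b + a * r) a 0F) ⟩
      orbit π ((b + a * r) + a)            ≡⟨ cong (orbit π) (+-assoc b (a * r) a) ⟩
      orbit π (b + (a * r + a))
        ≡⟨ cong (orbit π ∘ (b +_)) (trans (+-comm (a * r) a) (sym (*-suc a r))) ⟩
      orbit π (b + a * suc r)              ≡⟨ iter-+ (app π) b (a * suc r) 0F ⟩
      iter (app π) b (orbit π (a * suc r)) ≡⟨ cong (iter (app π) b) (orbit-multiple ret a) ⟩
      orbit π b                            ∎)
      where open ≡-Reasoning

module CyclicOrbit {n} (π : Perm (suc n)) (cyc : IsCyclic π) where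
  open Orbit π (proj₁ cyc) public

  orbit-below : 0 < r → orbit π r ≡ 0F → ∀ k → ∃ λ k′ → k′ < r × orbit π k ≡ orbit π k′
  orbit-below 0<r ret zero    = 0 , 0<r , refl
  orbit-below 0<r ret (suc k) with orbit-below 0<r ret k
  ... | k′ , k′<r , eq with m≤n⇒m<n∨m≡n k′<r
  ...   | inj₁ 1+k′<r = suc k′ , 1+k′<r , cong (app π) eq
  ...   | inj₂ refl   = 0 , 0<r , trans (cong (app π) eq) ret

  -- An earlier return would squeeze all of Fin (suc n) into the first r points of the orbit.
  orbit-≢0 : 0 < r → r < suc n → orbit π r ≢ 0F
  orbit-≢0 {r} 0<r r<N ret = collision (FP.pigeonhole r<N code)
    where
    reduced : ∀ y → ∃ λ k → k < r × orbit π k ≡ y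
    reduced y with proj₂ cyc 0F y
    ... | k , refl with orbit-below 0<r ret k
    ...   | k′ , k′<r , eq = k′ , k′<r , sym eq
    code : Fin (suc n) → Fin r
    code y = F.fromℕ< (proj₁ (proj₂ (reduced y)))
    decode : ∀ y → orbit π (toℕ (code y)) ≡ y
    decode y = trans (cong (orbit π) (FP.toℕ-fromℕ< (proj₁ (proj₂ (reduced y))))) (proj₂ (proj₂ (reduced y)))
    collision : ¬ ∃₂ λ y₁ y₂ → y₁ F.< y₂ × code y₁ ≡ code y₂
    collision (y₁ , y₂ , y₁<y₂ , same) =
      FP.<-irrefl (trans (sym (decode y₁)) (trans (cong (orbit π ∘ toℕ) same) (decode y₂))) y₁<y₂

  orbit-period : orbit π (suc n) ≡ 0F
  orbit-period with orbit-returns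
  ... | r , 0<r , r≤N , ret with m≤n⇒m<n∨m≡n r≤N
  ...   | inj₁ r<N  = ⊥-elim (orbit-≢0 0<r r<N ret)
  ...   | inj₂ refl = ret

  orbit-injective : i < suc n → j < suc n → orbit π i ≡ orbit π j → i ≡ j
  orbit-injective {i} {j} i<N j<N eq with <-cmp i j
  ... | tri< i<j _ _ =
    ⊥-elim (orbit-≢0 (m<n⇒0<n∸m i<j) (≤-<-trans (m∸n≤m j i) j<N) (orbit-shift (<⇒≤ i<j) eq))
  ... | tri≈ _ i≡j _ = i≡j
  ... | tri> _ _ j<i =
    ⊥-elim (orbit-≢0 (m<n⇒0<n∸m j<i) (≤-<-trans (m∸n≤m i j) i<N) (orbit-shift (<⇒≤ j<i) (sym eq)))

  orbit-surjective : ∀ y → ∃ λ k → k < suc n × orbit π k ≡ y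
  orbit-surjective y with proj₂ cyc 0F y
  ... | k , refl with orbit-below z<s orbit-period k
  ...   | k′ , k′<N , eq = k′ , k′<N , sym eq

-- Inserting 2 next to 1

-- In cycle notation both raise the values 2, …, n by one and then insert the new value 2
-- right after 1, resp. right before 1.
insertAfterOne : Perm (suc n) → Perm (2 + n)
insertAfterOne π = 1F ∷ V.map (punchIn 1F) π

insertBeforeOne : Perm (suc n) → Perm (2 + n)
insertBeforeOne (p ∷ ps) = F.suc p ∷ 0F ∷ V.map F.suc ps

-- Forgets the inserted element by identifying 2 with 1.
squash : Fin (2 + n) → Fin (suc n)
squash 0F        = 0F
squash (F.suc v) = v

squash-punchIn : (v : Fin (suc n)) → squash (punchIn 1F v) ≡ v
squash-punchIn 0F        = refl
squash-punchIn (F.suc v) = refl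

punchIn-1F : {v : Fin (suc n)} → v ≢ 0F → punchIn 1F v ≡ F.suc v
punchIn-1F {v = 0F}      v≢0 = ⊥-elim (v≢0 refl)
punchIn-1F {v = F.suc v} _   = refl

insertAfterOne-suc : (π : Perm (suc n)) (i : Fin (suc n)) →
                     app (insertAfterOne π) (F.suc i) ≡ punchIn 1F (app π i)
insertAfterOne-suc π i = VP.lookup-map i (punchIn 1F) π

insertBeforeOne-0 : (π : Perm (suc n)) → app (insertBeforeOne π) 0F ≡ F.suc (app π 0F)
insertBeforeOne-0 (p ∷ ps) = refl

insertBeforeOne-1 : (π : Perm (suc n)) → app (insertBeforeOne π) 1F ≡ 0F
insertBeforeOne-1 (p ∷ ps) = refl

insertBeforeOne-punchIn : (π : Perm (suc n)) (i : Fin (suc n)) →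
                          app (insertBeforeOne π) (punchIn 1F i) ≡ F.suc (app π i)
insertBeforeOne-punchIn (p ∷ ps) 0F        = refl
insertBeforeOne-punchIn (p ∷ ps) (F.suc i) = VP.lookup-map i F.suc ps

module _ (π : Perm (suc n)) where

  insertAfterOne-isPerm : IsPerm π → IsPerm (insertAfterOne π)
  insertAfterOne-isPerm inj 0F        0F        _  = refl
  insertAfterOne-isPerm inj 0F        (F.suc j) eq =
    ⊥-elim (FP.punchInᵢ≢i 1F (app π j) (sym (trans eq (insertAfterOne-suc π j))))
  insertAfterOne-isPerm inj (F.suc i) 0F        eq =
    ⊥-elim (FP.punchInᵢ≢i 1F (app π i) (trans (sym (insertAfterOne-suc π i)) eq))
  insertAfterOne-isPerm inj (F.suc i) (F.suc j) eq = cong F.suc (inj i j (FP.punchIn-injective 1F _ _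
    (trans (sym (insertAfterOne-suc π i)) (trans eq (insertAfterOne-suc π j)))))

  insertBeforeOne-isPerm : IsPerm π → IsPerm (insertBeforeOne π)
  insertBeforeOne-isPerm inj = positions
    where
    π′ : Perm (2 + n)
    π′ = insertBeforeOne π
    new≢old : ∀ a → app π′ 1F ≢ app π′ (punchIn 1F a)
    new≢old a eq with () ← trans (sym (insertBeforeOne-1 π)) (trans eq (insertBeforeOne-punchIn π a))
    old : ∀ a b → app π′ (punchIn 1F a) ≡ app π′ (punchIn 1F b) → punchIn 1F a ≡ punchIn 1F b
    old a b eq = cong (punchIn 1F) (inj a b (FP.suc-injective
      (trans (sym (insertBeforeOne-punchIn π a)) (trans eq (insertBeforeOne-punchIn π b)))))
    positions : IsPerm π′
    positions 1F                1F                _  = refl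
    positions 1F                0F                eq = ⊥-elim (new≢old 0F eq)
    positions 1F                (F.suc (F.suc j)) eq = ⊥-elim (new≢old (F.suc j) eq)
    positions 0F                1F                eq = ⊥-elim (new≢old 0F (sym eq))
    positions (F.suc (F.suc i)) 1F                eq = ⊥-elim (new≢old (F.suc i) (sym eq))
    positions 0F                0F                eq = old 0F 0F eq
    positions 0F                (F.suc (F.suc j)) eq = old 0F (F.suc j) eq
    positions (F.suc (F.suc i)) 0F                eq = old (F.suc i) 0F eq
    positions (F.suc (F.suc i)) (F.suc (F.suc j)) eq = old (F.suc i) (F.suc j) eq

  cyclic-insertAfterOne⁻ : IsCyclic (insertAfterOne π) → IsCyclic π
  cyclic-insertAfterOne⁻ (inj , connected) = π-inj , orbits-descend squash F.suc (λ _ → refl) step connected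
    where
    π-inj : IsPerm π
    π-inj i j eq = FP.suc-injective (inj (F.suc i) (F.suc j)
      (trans (insertAfterOne-suc π i) (trans (cong (punchIn 1F) eq) (sym (insertAfterOne-suc π j)))))
    step : ∀ a → squash (app (insertAfterOne π) a) ≡ squash a
               ⊎ squash (app (insertAfterOne π) a) ≡ app π (squash a)
    step 0F        = inj₁ refl
    step (F.suc a) = inj₂ (trans (cong squash (insertAfterOne-suc π a)) (squash-punchIn (app π a)))

  cyclic-insertBeforeOne⁻ : IsCyclic (insertBeforeOne π) → IsCyclic π
  cyclic-insertBeforeOne⁻ (inj , connected) = π-inj , orbits-descend squash F.suc (λ _ → refl) step connected
    where
    π-inj : IsPerm π
    π-inj i j eq = FP.punchIn-injective 1F i j (inj _ _
      (trans (insertBeforeOne-punchIn π i) (trans (cong F.suc eq) (sym (insertBeforeOne-punchIn π j)))))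
    step : ∀ a → squash (app (insertBeforeOne π) a) ≡ squash a
               ⊎ squash (app (insertBeforeOne π) a) ≡ app π (squash a)
    step 0F                = inj₂ (cong squash (insertBeforeOne-0 π))
    step 1F                = inj₁ (cong squash (insertBeforeOne-1 π))
    step (F.suc (F.suc a)) = inj₂ (cong squash (insertBeforeOne-punchIn π (F.suc a)))

module _ (π : Perm (suc n)) (cyc : IsCyclic π) where
  open CyclicOrbit π cyc

  orbit-insertAfterOne : k < suc n → orbit (insertAfterOne π) (suc k) ≡ F.suc (orbit π k)
  orbit-insertAfterOne {zero}  _   = refl
  orbit-insertAfterOne {suc k} k<N = begin
    app π′ (orbit π′ (suc k))    ≡⟨ cong (app π′) (orbit-insertAfterOne (<-trans (n<1+n k) k<N)) ⟩
    app π′ (F.suc (orbit π k))   ≡⟨ insertAfterOne-suc π (orbit π k) ⟩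
    punchIn 1F (orbit π (suc k)) ≡⟨ punchIn-1F (orbit-≢0 z<s k<N) ⟩
    F.suc (orbit π (suc k))      ∎
    where
    open ≡-Reasoning
    π′ : Perm (2 + n)
    π′ = insertAfterOne π

  orbit-insertBeforeOne : k < suc n → orbit (insertBeforeOne π) (suc k) ≡ F.suc (orbit π (suc k))
  orbit-insertBeforeOne {zero}  _   = insertBeforeOne-0 π
  orbit-insertBeforeOne {suc k} k<N = begin
    app π′ (orbit π′ (suc k))             ≡⟨ cong (app π′) (orbit-insertBeforeOne (<-trans (n<1+n k) k<N)) ⟩
    app π′ (F.suc (orbit π (suc k)))      ≡⟨ cong (app π′) (sym (punchIn-1F (orbit-≢0 z<s k<N))) ⟩
    app π′ (punchIn 1F (orbit π (suc k))) ≡⟨ insertBeforeOne-punchIn π (orbit π (suc k)) ⟩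
    F.suc (orbit π (suc (suc k)))         ∎
    where
    open ≡-Reasoning
    π′ : Perm (2 + n)
    π′ = insertBeforeOne π

  cyclic-insertAfterOne : IsCyclic (insertAfterOne π)
  cyclic-insertAfterOne = Orbit.cyclic-from-orbit (insertAfterOne π) (insertAfterOne-isPerm π (proj₁ cyc)) reach
    where
    reach : ∀ y → ∃ λ k → orbit (insertAfterOne π) k ≡ y
    reach 0F        = 0 , refl
    reach (F.suc y) with orbit-surjective y
    ... | k , k<N , refl = suc k , orbit-insertAfterOne k<N

  cyclic-insertBeforeOne : IsCyclic (insertBeforeOne π)
  cyclic-insertBeforeOne = Orbit.cyclic-from-orbit (insertBeforeOne π) (insertBeforeOne-isPerm π (proj₁ cyc)) reach
    where
    reach : ∀ y → ∃ λ k → orbit (insertBeforeOne π) k ≡ y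
    reach 0F        = 0 , refl
    reach (F.suc y) with orbit-surjective y
    ... | zero  , _   , refl = suc n , trans (orbit-insertBeforeOne ≤-refl) (cong F.suc orbit-period)
    ... | suc k , k<N , refl = suc k , orbit-insertBeforeOne (<-trans (n<1+n k) k<N)

map-∘-cancel : {f : B → A} {g : A → B} {k : ℕ} (v : Vec A k) →
               (∀ i → f (g (V.lookup v i)) ≡ V.lookup v i) → V.map f (V.map g v) ≡ v
map-∘-cancel []      _    = refl
map-∘-cancel (a ∷ v) f∘g≡ = cong₂ _∷_ (f∘g≡ 0F) (map-∘-cancel v (f∘g≡ ∘ F.suc))

insertAfterOne-view : (π′ : Perm (2 + n)) → IsPerm π′ → app π′ 0F ≡ 1F → ∃ λ π → π′ ≡ insertAfterOne π
insertAfterOne-view (_ ∷ vs) inj refl = V.map squash vs , cong (1F ∷_) (sym (map-∘-cancel vs punchIn-squash))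
  where
  punchIn-squash : ∀ i → punchIn 1F (squash (V.lookup vs i)) ≡ V.lookup vs i
  punchIn-squash i with V.lookup vs i in eq
  ... | 0F              = refl
  ... | 1F              with () ← inj (F.suc i) 0F eq
  ... | F.suc (F.suc v) = refl

insertBeforeOne-view : (π′ : Perm (2 + n)) → IsPerm π′ → app π′ 1F ≡ 0F → ∃ λ π → π′ ≡ insertBeforeOne π
insertBeforeOne-view (0F      ∷ _ ∷ _)  inj refl with () ← inj 0F 1F refl
insertBeforeOne-view (F.suc a ∷ _ ∷ vs) inj refl =
  a ∷ V.map squash vs , cong (λ ws → F.suc a ∷ 0F ∷ ws) (sym (map-∘-cancel vs suc-squash))
  where
  suc-squash : ∀ i → F.suc (squash (V.lookup vs i)) ≡ V.lookup vs i
  suc-squash i with V.lookup vs i in eq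
  ... | 0F      with () ← inj (F.suc (F.suc i)) 1F eq
  ... | F.suc v = refl

insertAfterOne-injective : {π π′ : Perm (suc n)} → insertAfterOne π ≡ insertAfterOne π′ → π ≡ π′
insertAfterOne-injective {π = π} {π′} eq = begin
  π                                    ≡⟨ sym (map-∘-cancel π (squash-punchIn ∘ V.lookup π)) ⟩
  V.map squash (V.map (punchIn 1F) π)  ≡⟨ cong (V.map squash) (VP.∷-injectiveʳ eq) ⟩
  V.map squash (V.map (punchIn 1F) π′) ≡⟨ map-∘-cancel π′ (squash-punchIn ∘ V.lookup π′) ⟩
  π′                                   ∎
  where open ≡-Reasoning

insertBeforeOne-injective : {π π′ : Perm (suc n)} → insertBeforeOne π ≡ insertBeforeOne π′ → π ≡ π′
insertBeforeOne-injective {π = p ∷ ps} {p′ ∷ ps′} eq = cong₂ _∷_ (FP.suc-injective (VP.∷-injectiveˡ eq)) (begin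
  ps                             ≡⟨ sym (map-∘-cancel ps (λ _ → refl)) ⟩
  V.map squash (V.map F.suc ps)  ≡⟨ cong (V.map squash) (VP.∷-injectiveʳ (VP.∷-injectiveʳ eq)) ⟩
  V.map squash (V.map F.suc ps′) ≡⟨ map-∘-cancel ps′ (λ _ → refl) ⟩
  ps′                            ∎)
  where open ≡-Reasoning

value : Fin n → ℕ
value v = suc (toℕ v)

cycleEntry : Perm (suc n) → ℕ → ℕ
cycleEntry π k = value (orbit π k)

cycleTail : Perm (suc n) → List ℕ
cycleTail {n} π = map (cycleEntry π) (applyUpTo suc n)

map-suc-positive : (f : A → ℕ) (xs : List A) → All (1 ≤_) (map (suc ∘ f) xs)
map-suc-positive f xs = AllP.map⁺ (All.universal (λ _ → s≤s z≤n) xs)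

module _ (π : Perm (suc n)) (cyc : IsCyclic π) where
  open CyclicOrbit π cyc

  cycleForm-insertAfterOne : cycleForm (insertAfterOne π) ≡ 1 ∷ map suc (cycleForm π)
  cycleForm-insertAfterOne = cong (1 ∷_) (begin
    map (cycleEntry π′) (applyUpTo suc (suc n))  ≡⟨ cong (map (cycleEntry π′)) (sym (LP.map-upTo suc (suc n))) ⟩
    map (cycleEntry π′) (map suc (upTo (suc n))) ≡⟨ sym (LP.map-∘ (upTo (suc n))) ⟩
    map (cycleEntry π′ ∘ suc) (upTo (suc n))     ≡⟨ LP.map-cong-local (AllP.applyUpTo⁺₁ id (suc n)
                                                      (cong value ∘ orbit-insertAfterOne π cyc)) ⟩
    map (suc ∘ cycleEntry π) (upTo (suc n))      ≡⟨ LP.map-∘ (upTo (suc n)) ⟩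
    map suc (map (cycleEntry π) (upTo (suc n)))  ∎)
    where
    open ≡-Reasoning
    π′ : Perm (2 + n)
    π′ = insertAfterOne π

  cycleForm-insertBeforeOne : cycleForm (insertBeforeOne π) ≡ 1 ∷ (map suc (cycleTail π) ++ 2 ∷ [])
  cycleForm-insertBeforeOne = cong (1 ∷_) (begin
    map (cycleEntry π′) (applyUpTo suc (suc n))
      ≡⟨ cong (map (cycleEntry π′)) (sym (LP.applyUpTo-∷ʳ suc n)) ⟩
    map (cycleEntry π′) (applyUpTo suc n ++ suc n ∷ [])
      ≡⟨ LP.map-++ (cycleEntry π′) (applyUpTo suc n) (suc n ∷ []) ⟩
    map (cycleEntry π′) (applyUpTo suc n) ++ cycleEntry π′ (suc n) ∷ []
      ≡⟨ cong₂ (λ ws v → ws ++ v ∷ []) shifted last-is-2 ⟩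
    map (suc ∘ cycleEntry π) (applyUpTo suc n) ++ 2 ∷ []
      ≡⟨ cong (_++ 2 ∷ []) (LP.map-∘ (applyUpTo suc n)) ⟩
    map suc (cycleTail π) ++ 2 ∷ [] ∎)
    where
    open ≡-Reasoning
    π′ : Perm (2 + n)
    π′ = insertBeforeOne π
    shifted : map (cycleEntry π′) (applyUpTo suc n) ≡ map (suc ∘ cycleEntry π) (applyUpTo suc n)
    shifted = LP.map-cong-local (AllP.applyUpTo⁺₁ suc n
      (λ k<n → cong value (orbit-insertBeforeOne π cyc (<-trans k<n (n<1+n n)))))
    last-is-2 : cycleEntry π′ (suc n) ≡ 2
    last-is-2 = cong value (trans (orbit-insertBeforeOne π cyc ≤-refl) (cong F.suc orbit-period))

  cycleTail-≥2 : All (2 ≤_) (cycleTail π)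
  cycleTail-≥2 = AllP.map⁺ (AllP.applyUpTo⁺₁ suc n (λ k<n → s≤s (≢0⇒≥1 (orbit-≢0 z<s (s≤s k<n)))))
    where
    ≢0⇒≥1 : {v : Fin (suc n)} → v ≢ 0F → 1 ≤ toℕ v
    ≢0⇒≥1 {0F}      v≢0 = ⊥-elim (v≢0 refl)
    ≢0⇒≥1 {F.suc v} _   = s≤s z≤n

oneLine-insertAfterOne : (π : Perm (suc n)) →
                         oneLine (insertAfterOne π) ≡ 2 ∷ map (value ∘ punchIn 1F) (V.toList π)
oneLine-insertAfterOne π =
  cong (2 ∷_) (trans (cong (map value) (VP.toList-map (punchIn 1F) π)) (sym (LP.map-∘ (V.toList π))))

oneLine-insertBeforeOne : (p : Fin (suc n)) (ps : Vec (Fin (suc n)) n) →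
                          oneLine (insertBeforeOne (p ∷ ps))
                            ≡ value (F.suc p) ∷ 1 ∷ map (value ∘ F.suc) (V.toList ps)
oneLine-insertBeforeOne p ps = cong (λ w → value (F.suc p) ∷ 1 ∷ w)
  (trans (cong (map value) (VP.toList-map F.suc ps)) (sym (LP.map-∘ (V.toList ps))))

punchIn-orderEquivalent : OrderEquivalent (value ∘ punchIn {suc n} 1F) value
punchIn-orderEquivalent a b = mk⇔
  (λ lt → s≤s (≰⇒> (λ b≤a → <⇒≱ (s≤s⁻¹ lt) (FP.punchIn-mono-≤ 1F b a b≤a))))
  (λ lt → s≤s (≰⇒> (λ b≤a → <⇒≱ (s≤s⁻¹ lt) (FP.punchIn-cancel-≤ 1F b a b≤a))))

module _ {σ : List ℕ} (stable : OneLineStable σ) where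
  open OneLineStable stable

  contains-oneLine-insertAfterOne : (π : Perm (suc n)) →
                                    Contains (oneLine (insertAfterOne π)) σ ⇔ Contains (oneLine π) σ
  contains-oneLine-insertAfterOne π = mk⇔
    (contains-map {σ = σ} punchIn-orderEquivalent (V.toList π)
      ∘ contains-∷⁻ {σ = σ} no-head-2 (map-suc-positive (toℕ ∘ punchIn 1F) (V.toList π))
      ∘ subst (λ w → Contains w σ) (oneLine-insertAfterOne π))
    (subst (λ w → Contains w σ) (sym (oneLine-insertAfterOne π))
      ∘ contains-⊆ {σ = σ} (2 ∷ʳ ⊆-refl)
      ∘ contains-map {σ = σ} (orderEquivalent-sym punchIn-orderEquivalent) (V.toList π))

  contains-oneLine-insertBeforeOne : (π : Perm (suc n)) →
                                     Contains (oneLine (insertBeforeOne π)) σ ⇔ Contains (oneLine π) σ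
  contains-oneLine-insertBeforeOne (p ∷ ps) = mk⇔
    (contains-map {σ = σ} (suc-orderEquivalent value) (V.toList (p ∷ ps))
      ∘ contains-∷∷⁻ {σ = σ} no-head-1 no-second-1 (map-suc-positive (toℕ ∘ F.suc) (V.toList ps))
      ∘ subst (λ w → Contains w σ) (oneLine-insertBeforeOne p ps))
    (subst (λ w → Contains w σ) (sym (oneLine-insertBeforeOne p ps))
      ∘ contains-⊆ {σ = σ} (refl ∷ 1 ∷ʳ ⊆-refl)
      ∘ contains-map {σ = σ} (orderEquivalent-sym (suc-orderEquivalent value)) (V.toList (p ∷ ps)))

module _ {ρ : List ℕ} (stable : CycleStable ρ) (π : Perm (suc n)) (cyc : IsCyclic π) where
  open CycleStable stable

  contains-cycleForm-insertAfterOne : Contains (cycleForm (insertAfterOne π)) ρ ⇔ Contains (cycleForm π) ρ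
  contains-cycleForm-insertAfterOne = mk⇔
    (to (contains-map-suc {σ = ρ})
      ∘ contains-∷⁻ {σ = ρ} no-head-1 (map-suc-positive id (cycleForm π))
      ∘ subst (λ w → Contains w ρ) (cycleForm-insertAfterOne π cyc))
    (subst (λ w → Contains w ρ) (sym (cycleForm-insertAfterOne π cyc))
      ∘ contains-⊆ {σ = ρ} (1 ∷ʳ ⊆-refl)
      ∘ from (contains-map-suc {σ = ρ}))

  contains-cycleForm-insertBeforeOne : Contains (cycleForm (insertBeforeOne π)) ρ ⇔ Contains (cycleForm π) ρ
  contains-cycleForm-insertBeforeOne = mk⇔
    (contains-⊆ {σ = ρ} (1 ∷ʳ ⊆-refl)
      ∘ to (contains-map-suc {σ = ρ})
      ∘ contains-∷ʳ⁻ {σ = ρ} no-last-2 (AllP.map⁺ (All.map s≤s (cycleTail-≥2 π cyc)))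
      ∘ contains-∷⁻ {σ = ρ} no-head-1 (AllP.++⁺ (map-suc-positive id (cycleTail π)) (s≤s z≤n ∷ []))
      ∘ subst (λ w → Contains w ρ) (cycleForm-insertBeforeOne π cyc))
    (subst (λ w → Contains w ρ) (sym (cycleForm-insertBeforeOne π cyc))
      ∘ contains-⊆ {σ = ρ} (1 ∷ʳ SubP.++⁺ʳ (2 ∷ []) ⊆-refl)
      ∘ from (contains-map-suc {σ = ρ})
      ∘ contains-∷⁻ {σ = ρ} no-head-1 (map-suc-positive (toℕ ∘ orbit π) (applyUpTo suc n)))

module _ {σs : List (List ℕ)} {ρ : List ℕ} (oneLine-stable : All OneLineStable σs)
         (cycle-stable : CycleStable ρ) (π : Perm (suc n)) where

  InA-insertAfterOne : InA (2 + n) σs ρ (insertAfterOne π) ⇔ InA (suc n) σs ρ π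
  InA-insertAfterOne = mk⇔
    (λ (cyc′ , avoid , avoidρ) → let cyc = cyclic-insertAfterOne⁻ π cyc′ in
      cyc , to oneLines avoid , to (cycleForms cyc) avoidρ)
    (λ (cyc , avoid , avoidρ) →
      cyclic-insertAfterOne π cyc , from oneLines avoid , from (cycleForms cyc) avoidρ)
    where
    oneLines : All (Avoids (oneLine (insertAfterOne π))) σs ⇔ All (Avoids (oneLine π)) σs
    oneLines = all-avoids oneLine-stable (λ stable → contains-oneLine-insertAfterOne stable π)
    cycleForms : IsCyclic π → Avoids (cycleForm (insertAfterOne π)) ρ ⇔ Avoids (cycleForm π) ρ
    cycleForms cyc = avoids-cong {σ = ρ} (contains-cycleForm-insertAfterOne cycle-stable π cyc)

  InA-insertBeforeOne : InA (2 + n) σs ρ (insertBeforeOne π) ⇔ InA (suc n) σs ρ π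
  InA-insertBeforeOne = mk⇔
    (λ (cyc′ , avoid , avoidρ) → let cyc = cyclic-insertBeforeOne⁻ π cyc′ in
      cyc , to oneLines avoid , to (cycleForms cyc) avoidρ)
    (λ (cyc , avoid , avoidρ) →
      cyclic-insertBeforeOne π cyc , from oneLines avoid , from (cycleForms cyc) avoidρ)
    where
    oneLines : All (Avoids (oneLine (insertBeforeOne π))) σs ⇔ All (Avoids (oneLine π)) σs
    oneLines = all-avoids oneLine-stable (λ stable → contains-oneLine-insertBeforeOne stable π)
    cycleForms : IsCyclic π → Avoids (cycleForm (insertBeforeOne π)) ρ ⇔ Avoids (cycleForm π) ρ
    cycleForms cyc = avoids-cong {σ = ρ} (contains-cycleForm-insertBeforeOne cycle-stable π cyc)

-- When 2 is not next to 1

applyUpTo-⊆₁ : (f : ℕ → A) → i < n → f i ∷ [] ⊆ applyUpTo f n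
applyUpTo-⊆₁ {i = zero}  {n = suc n} f _         = refl ∷ minimum _
applyUpTo-⊆₁ {i = suc i} {n = suc n} f (s<s i<n) = f 0 ∷ʳ applyUpTo-⊆₁ (f ∘ suc) i<n

applyUpTo-⊆₂ : (f : ℕ → A) → i < j → j < n → f i ∷ f j ∷ [] ⊆ applyUpTo f n
applyUpTo-⊆₂ {i = zero}  {j = suc j} {n = suc n} f _         (s<s j<n) = refl ∷ applyUpTo-⊆₁ (f ∘ suc) j<n
applyUpTo-⊆₂ {i = suc i} {j = suc j} {n = suc n} f (s<s i<j) (s<s j<n) = f 0 ∷ʳ applyUpTo-⊆₂ (f ∘ suc) i<j j<n

applyUpTo-⊆₃ : (f : ℕ → A) → i < j → j < k → k < n → f i ∷ f j ∷ f k ∷ [] ⊆ applyUpTo f n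
applyUpTo-⊆₃ {i = zero}  {j = suc j} {k = suc k} {n = suc n} f _ (s<s j<k) (s<s k<n) =
  refl ∷ applyUpTo-⊆₂ (f ∘ suc) j<k k<n
applyUpTo-⊆₃ {i = suc i} {j = suc j} {k = suc k} {n = suc n} f (s<s i<j) (s<s j<k) (s<s k<n) =
  f 0 ∷ʳ applyUpTo-⊆₃ (f ∘ suc) i<j j<k k<n

lookup-⊆₁ : (v : Vec A n) (i : Fin n) → V.lookup v i ∷ [] ⊆ V.toList v
lookup-⊆₁ (a ∷ v) 0F        = refl ∷ minimum _
lookup-⊆₁ (a ∷ v) (F.suc i) = a ∷ʳ lookup-⊆₁ v i

lookup-⊆₂ : (v : Vec A n) {i j : Fin n} → i F.< j → V.lookup v i ∷ V.lookup v j ∷ [] ⊆ V.toList v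
lookup-⊆₂ (a ∷ v) {0F}      {F.suc j} _         = refl ∷ lookup-⊆₁ v j
lookup-⊆₂ (a ∷ v) {F.suc i} {F.suc j} (s<s i<j) = a ∷ʳ lookup-⊆₂ v i<j

oneLine-⊆ : (π : Perm (2 + n)) {i j : Fin (2 + n)} → 2 ≤ toℕ i → i F.< j →
            value (app π 0F) ∷ value (app π 1F) ∷ value (app π i) ∷ value (app π j) ∷ [] ⊆ oneLine π
oneLine-⊆ (a ∷ b ∷ v) {F.suc (F.suc i)} {F.suc (F.suc j)} _ (s<s (s<s i<j)) =
  refl ∷ refl ∷ SubP.map⁺ value (lookup-⊆₂ v i<j)
oneLine-⊆ _ {1F} (s≤s ())

2≤toℕ : {v : Fin (2 + n)} → v ≢ 0F → v ≢ 1F → 2 ≤ toℕ v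
2≤toℕ {v = 0F}              v≢0 _   = ⊥-elim (v≢0 refl)
2≤toℕ {v = 1F}              _   v≢1 = ⊥-elim (v≢1 refl)
2≤toℕ {v = F.suc (F.suc _)} _   _   = s≤s (s≤s z≤n)

module _ {m} (π : Perm (3 + m)) (cyc : IsCyclic π) (π0≢1 : app π 0F ≢ 1F) (π1≢0 : app π 1F ≢ 0F) where
  open CyclicOrbit π cyc

  two-inside : ∃ λ q → q < m × orbit π (2 + q) ≡ 1F
  two-inside with orbit-surjective 1F
  ... | 1           , _   , eq = ⊥-elim (π0≢1 eq)
  ... | suc (suc q) , q<N , eq with m≤n⇒m<n∨m≡n (s≤s⁻¹ (s≤s⁻¹ (s≤s⁻¹ q<N)))
  ...   | inj₁ q<m  = q , q<m , eq
  ...   | inj₂ refl = ⊥-elim (π1≢0 (trans (cong (app π) (sym eq)) orbit-period))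

  -- e k is the (k+1)-st entry of the cycle form (1, a, …, μ, 2, b, …, ℓ), with 2 = e (2 + q);
  -- a = π(1), b = π(2), π(μ) = 2, π(ℓ) = 1, all of them at least 3.
  private module _ {q} (q<m : q < m) (two : orbit π (2 + q) ≡ 1F) where
    private
      e : ℕ → ℕ
      e = cycleEntry π

      a b μ ℓ : ℕ
      a = e 1
      b = e (3 + q)
      μ = e (1 + q)
      ℓ = e (2 + m)

      ≥3 : k < 3 + m → k ≢ 0 → k ≢ 2 + q → 3 ≤ e k
      ≥3 k<N k≢0 k≢2+q = s≤s (2≤toℕ
        (λ eq → k≢0 (orbit-injective k<N z<s eq))
        (λ eq → k≢2+q (orbit-injective k<N (s≤s (s≤s (s≤s (<⇒≤ q<m)))) (trans eq (sym two)))))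

      a≥3 : 3 ≤ a
      a≥3 = ≥3 (s≤s (s≤s z≤n)) (λ ()) (λ ())
      b≥3 : 3 ≤ b
      b≥3 = ≥3 (s≤s (s≤s (s≤s q<m))) (λ ()) (λ eq → <-irrefl (sym eq) (n<1+n (2 + q)))
      μ≥3 : 3 ≤ μ
      μ≥3 = ≥3 (s≤s (s≤s (m≤n⇒m≤1+n (<⇒≤ q<m)))) (λ ()) (λ eq → <-irrefl eq (n<1+n (1 + q)))
      ℓ≥3 : 3 ≤ ℓ
      ℓ≥3 = ≥3 ≤-refl (λ ()) (λ eq → <-irrefl (sym (suc-injective (suc-injective eq))) q<m)

      e-two : e (2 + q) ≡ 2
      e-two = cong value two

      2< : 3 ≤ x → e (2 + q) < x
      2< {x} = subst (_< x) (sym e-two)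

      1<2 : e (3 + m) < e (2 + q)
      1<2 = subst₂ _<_ (sym (cong value orbit-period)) (sym e-two) ≤-refl

      a≢b : a ≢ b
      a≢b eq = 0≢1+n (suc-injective (orbit-injective {i = 1} {j = 3 + q} (s≤s (s≤s z≤n)) (s≤s (s≤s (s≤s q<m)))
        (FP.toℕ-injective {i = orbit π 1} {j = orbit π (3 + q)} (suc-injective eq))))

      μ≢ℓ : μ ≢ ℓ
      μ≢ℓ eq = <-irrefl
        (suc-injective (orbit-injective {i = 1 + q} {j = 2 + m} (s≤s (s≤s (m≤n⇒m≤1+n (<⇒≤ q<m)))) ≤-refl
          (FP.toℕ-injective {i = orbit π (1 + q)} {j = orbit π (2 + m)} (suc-injective eq))))
        (m≤n⇒m≤1+n q<m)

      π1≡b : value (app π 1F) ≡ b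
      π1≡b = cong (value ∘ app π) (sym two)

      a2b-⊆ : a ∷ e (2 + q) ∷ b ∷ [] ⊆ cycleForm π
      a2b-⊆ = SubP.map⁺ e (applyUpTo-⊆₃ id (s≤s (s≤s z≤n)) ≤-refl (s≤s (s≤s (s≤s q<m))))

      μ2ℓ-⊆ : μ ∷ e (2 + q) ∷ ℓ ∷ [] ⊆ cycleForm π
      μ2ℓ-⊆ = SubP.map⁺ e (applyUpTo-⊆₃ id ≤-refl (s≤s (s≤s q<m)) ≤-refl)

    213-or-4312 : Contains (cycleForm π) σ213 ⊎ Contains (oneLine π) σ4312
    213-or-4312 with <-cmp a b
    ... | tri< a<b _ _ = inj₁ (_ , a2b-⊆ , 213-occurrence (2< a≥3) (<⇒≤ a<b))
    ... | tri≈ _ a≡b _ = ⊥-elim (a≢b a≡b)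
    ... | tri> _ _ b<a with <-cmp μ ℓ
    ...   | tri< μ<ℓ _ _ = inj₁ (_ , μ2ℓ-⊆ , 213-occurrence (2< μ≥3) (<⇒≤ μ<ℓ))
    ...   | tri≈ _ μ≡ℓ _ = ⊥-elim (μ≢ℓ μ≡ℓ)
    ...   | tri> _ _ ℓ<μ = inj₂ (_ , oneLine-⊆ π {orbit π (2 + m)} {orbit π (1 + q)} (s≤s⁻¹ ℓ≥3) (s≤s⁻¹ ℓ<μ) ,
            4312-occurrence (<⇒≤ 1<2) (subst (e (2 + q) <_) (sym π1≡b) (2< b≥3)) (subst (_< a) (sym π1≡b) b<a))

    312-or-3421 : Contains (cycleForm π) σ312 ⊎ Contains (oneLine π) σ3421
    312-or-3421 with <-cmp a b
    ... | tri> _ _ b<a = inj₁ (_ , a2b-⊆ , 312-occurrence (<⇒≤ (2< b≥3)) b<a)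
    ... | tri≈ _ a≡b _ = ⊥-elim (a≢b a≡b)
    ... | tri< a<b _ _ with <-cmp μ ℓ
    ...   | tri> _ _ ℓ<μ = inj₁ (_ , μ2ℓ-⊆ , 312-occurrence (<⇒≤ (2< ℓ≥3)) ℓ<μ)
    ...   | tri≈ _ μ≡ℓ _ = ⊥-elim (μ≢ℓ μ≡ℓ)
    ...   | tri< μ<ℓ _ _ = inj₂ (_ , oneLine-⊆ π {orbit π (1 + q)} {orbit π (2 + m)} (s≤s⁻¹ μ≥3) (s≤s⁻¹ μ<ℓ) ,
            3421-occurrence 1<2 (2< a≥3) (subst (a ≤_) (sym π1≡b) (<⇒≤ a<b)))

  contains-213-or-4312 : Contains (cycleForm π) σ213 ⊎ Contains (oneLine π) σ4312
  contains-213-or-4312 with two-inside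
  ... | _ , q<m , two = 213-or-4312 q<m two

  contains-312-or-3421 : Contains (cycleForm π) σ312 ⊎ Contains (oneLine π) σ3421
  contains-312-or-3421 with two-inside
  ... | _ , q<m , two = 312-or-3421 q<m two

twoCycle : Perm 2
twoCycle = 1F ∷ 0F ∷ []

insertions : ∀ m → List (Perm (2 + m))
insertions zero    = twoCycle ∷ []
insertions (suc m) = map insertAfterOne (insertions m) ++ map insertBeforeOne (insertions m)

length-insertions : ∀ m → length (insertions m) ≡ 2 ^ m
length-insertions zero    = refl
length-insertions (suc m) = begin
  length (map insertAfterOne πs ++ map insertBeforeOne πs)
    ≡⟨ LP.length-++ (map insertAfterOne πs) ⟩
  length (map insertAfterOne πs) + length (map insertBeforeOne πs)
    ≡⟨ cong₂ _+_ (LP.length-map insertAfterOne πs) (LP.length-map insertBeforeOne πs) ⟩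
  length πs + length πs
    ≡⟨ cong₂ _+_ (length-insertions m) (length-insertions m) ⟩
  2 ^ m + 2 ^ m
    ≡⟨ cong (2 ^ m +_) (sym (+-identityʳ (2 ^ m))) ⟩
  2 ^ suc m ∎
  where
  open ≡-Reasoning
  πs : List (Perm (2 + m))
  πs = insertions m

insertions-head≢0 : ∀ m {π} → π ∈ insertions m → app π 0F ≢ 0F
insertions-head≢0 zero    (here refl) ()
insertions-head≢0 (suc m) π∈ with ∈-++⁻ (map insertAfterOne (insertions m)) π∈
... | inj₁ π∈after  with _ , _ , refl ← ∈-map⁻ insertAfterOne π∈after = λ ()
... | inj₂ π∈before with π′ , _ , refl ← ∈-map⁻ insertBeforeOne π∈before =
  λ eq → FP.0≢1+n (trans (sym eq) (insertBeforeOne-0 π′))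

insertions-unique : ∀ m → Unique (insertions m)
insertions-unique zero    = [] AllPairs.∷ AllPairs.[]
insertions-unique (suc m) = UniqueP.++⁺ (UniqueP.map⁺ insertAfterOne-injective (insertions-unique m))
                                        (UniqueP.map⁺ insertBeforeOne-injective (insertions-unique m)) disjoint
  where
  disjoint : ∀ {π} → ¬ (π ∈ map insertAfterOne (insertions m) × π ∈ map insertBeforeOne (insertions m))
  disjoint (π∈after , π∈before) with ∈-map⁻ insertAfterOne π∈after | ∈-map⁻ insertBeforeOne π∈before
  ... | _ , _ , refl | p ∷ _ , π′∈ , eq = insertions-head≢0 m π′∈ (FP.suc-injective (sym (VP.∷-injectiveˡ eq)))

module Enumeration
  (P : ∀ m → Perm (2 + m) → Set)
  (P-base   : ∀ π → P 0 π ⇔ π ≡ twoCycle)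
  (P-after  : ∀ {m} (π : Perm (2 + m)) → P (suc m) (insertAfterOne π) ⇔ P m π)
  (P-before : ∀ {m} (π : Perm (2 + m)) → P (suc m) (insertBeforeOne π) ⇔ P m π)
  (P-split  : ∀ {m} (π : Perm (3 + m)) → P (suc m) π →
              (∃ λ π′ → π ≡ insertAfterOne π′) ⊎ (∃ λ π′ → π ≡ insertBeforeOne π′))
  where

  ∈-insertions : ∀ m π → π ∈ insertions m ⇔ P m π
  ∈-insertions zero    π = mk⇔ (λ { (here refl) → from (P-base twoCycle) refl }) (here ∘ to (P-base π))
  ∈-insertions (suc m) π = mk⇔ sound complete
    where
    sound : π ∈ insertions (suc m) → P (suc m) π
    sound π∈ with ∈-++⁻ (map insertAfterOne (insertions m)) π∈
    ... | inj₁ π∈after  with π′ , π′∈ , refl ← ∈-map⁻ insertAfterOne π∈after =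
      from (P-after π′) (to (∈-insertions m π′) π′∈)
    ... | inj₂ π∈before with π′ , π′∈ , refl ← ∈-map⁻ insertBeforeOne π∈before =
      from (P-before π′) (to (∈-insertions m π′) π′∈)
    complete : P (suc m) π → π ∈ insertions (suc m)
    complete Pπ with P-split π Pπ
    ... | inj₁ (π′ , refl) =
      ∈-++⁺ˡ (∈-map⁺ insertAfterOne (from (∈-insertions m π′) (to (P-after π′) Pπ)))
    ... | inj₂ (π′ , refl) = ∈-++⁺ʳ (map insertAfterOne (insertions m))
      (∈-map⁺ insertBeforeOne (from (∈-insertions m π′) (to (P-before π′) Pπ)))

  count : ∀ m → HasCard (P m) (2 ^ m)
  count m = insertions m , insertions-unique m , ∈-insertions m , length-insertions m

cyclic-twoCycle : IsCyclic twoCycle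
cyclic-twoCycle = cyclic-insertAfterOne (0F ∷ []) ((λ { 0F 0F _ → refl }) , (λ { 0F 0F → 0 , refl }))

cyclic-Perm2 : (π : Perm 2) → IsCyclic π → π ≡ twoCycle
cyclic-Perm2 (0F ∷ _ ∷ [])  (_ , connected) with k , 0F≡1F ← connected 0F 1F
  with () ← trans (sym (iter-fixed refl k)) 0F≡1F
cyclic-Perm2 (1F ∷ 0F ∷ []) _         = refl
cyclic-Perm2 (1F ∷ 1F ∷ []) (inj , _) with () ← inj 0F 1F refl

InA-twoCycle : {σs : List (List ℕ)} {ρ : List ℕ} →
               All (λ σ → 2 < length σ) σs → 2 < length ρ → InA 2 σs ρ twoCycle
InA-twoCycle {ρ = ρ} long-σs long-ρ = cyclic-twoCycle ,
  All.map (λ {σ} → avoids-shorter {w = oneLine twoCycle} {σ = σ}) long-σs ,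
  avoids-shorter {w = cycleForm twoCycle} {σ = ρ} long-ρ

module _ {σs : List (List ℕ)} {ρ : List ℕ}
  (oneLine-stable : All OneLineStable σs) (cycle-stable : CycleStable ρ)
  (long-σs : All (λ σ → 2 < length σ) σs) (long-ρ : 2 < length ρ)
  (forced : ∀ {m} (π : Perm (3 + m)) → InA (3 + m) σs ρ π → app π 0F ≢ 1F → app π 1F ≢ 0F → ⊥)
  where

  aCount-insertions : ∀ m → aCount (2 + m) σs ρ (2 ^ m)
  aCount-insertions = Enumeration.count (λ m → InA (2 + m) σs ρ) base
    (InA-insertAfterOne oneLine-stable cycle-stable) (InA-insertBeforeOne oneLine-stable cycle-stable) split
    where
    base : ∀ π → InA 2 σs ρ π ⇔ π ≡ twoCycle
    base π = mk⇔ (cyclic-Perm2 π ∘ proj₁) (λ { refl → InA-twoCycle {ρ = ρ} long-σs long-ρ })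
    split : ∀ {m} (π : Perm (3 + m)) → InA (3 + m) σs ρ π →
            (∃ λ π′ → π ≡ insertAfterOne π′) ⊎ (∃ λ π′ → π ≡ insertBeforeOne π′)
    split π inA with app π 0F FP.≟ 1F | app π 1F FP.≟ 0F
    ... | yes π0≡1 | _        = inj₁ (insertAfterOne-view π (proj₁ (proj₁ inA)) π0≡1)
    ... | no _     | yes π1≡0 = inj₂ (insertBeforeOne-view π (proj₁ (proj₁ inA)) π1≡0)
    ... | no π0≢1  | no π1≢0  = ⊥-elim (forced π inA π0≢1 π1≢0)

4312-213-forces-insertion : ∀ {m} (π : Perm (3 + m)) → InA (3 + m) (σ4312 ∷ σ4321 ∷ []) σ213 π →
                            app π 0F ≢ 1F → app π 1F ≢ 0F → ⊥
4312-213-forces-insertion π (cyc , avoid-4312 ∷ _ , avoid-213) π0≢1 π1≢0 =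
  [ avoid-213 , avoid-4312 ]′ (contains-213-or-4312 π cyc π0≢1 π1≢0)

3421-312-forces-insertion : ∀ {m} (π : Perm (3 + m)) → InA (3 + m) (σ3421 ∷ σ4321 ∷ []) σ312 π →
                            app π 0F ≢ 1F → app π 1F ≢ 0F → ⊥
3421-312-forces-insertion π (cyc , avoid-3421 ∷ _ , avoid-312) π0≢1 π1≢0 =
  [ avoid-312 , avoid-3421 ]′ (contains-312-or-3421 π cyc π0≢1 π1≢0)

theorem3p7 : (n : ℕ) → 2 ≤ n →
    aCount n ((4 ∷ 3 ∷ 1 ∷ 2 ∷ []) ∷ (4 ∷ 3 ∷ 2 ∷ 1 ∷ []) ∷ []) (2 ∷ 1 ∷ 3 ∷ []) (2 ^ (n ∸ 2))
    × aCount n ((3 ∷ 4 ∷ 2 ∷ 1 ∷ []) ∷ (4 ∷ 3 ∷ 2 ∷ 1 ∷ []) ∷ []) (3 ∷ 1 ∷ 2 ∷ []) (2 ^ (n ∸ 2))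
theorem3p7 (suc (suc m)) (s≤s (s≤s z≤n)) =
  aCount-insertions (4312-stable ∷ 4321-stable ∷ []) 213-stable (auto ∷ auto ∷ []) auto
    4312-213-forces-insertion m ,
  aCount-insertions (3421-stable ∷ 4321-stable ∷ []) 312-stable (auto ∷ auto ∷ []) auto
    3421-312-forces-insertion m
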